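{- Let $G$ be a finite simple graph such that $L=\mathrm{co}(G)$ is disconnected. Then $G$ (with isolated vertices removed) is one of the following: (i) $K_{1,\lambda}$ for some $\lambda\ge 1$, with $c(L)=\lambda$ and $\rho(G)=2\lambda$; (ii) a graph of type-$A$, with $c(L)=2$ and $\rho(G)=|E(G)|+2$; (iii) $C_4$, with $c(L)=2$ and $\rho(G)=6$; (iv) $F_k$ for some $k\ge 2$, with $c(L)=3$ and $\rho(G)=k+4$; (v) $K_4^-$, with $c(L)=3$ and $\rho(G)=8$; (vi) $K_4$, with $c(L)=3$ and $\rho(G)=9$.
   Context: The coline graph $\mathrm{co}(G)$ of a graph $G$ has vertex set $E(G)$, two vertices $e\neq e'$ being adjacent iff $e,e'$ share no endpoint in $G$. $c(H)$ denotes the number of connected components of $H$. For a graph $G'$ with $\mathrm{co}(G')$ disconnected, $\rho(G')=|E(G')|+c(\mathrm{co}(G'))$. A graph $G$ is of type-$A$ if $G$ has an edge $e$ that shares an endpoint with every other edge of $G$ and $\mathrm{co}(G)$ has exactly $2$ components. For $k\ge 2$, $F_k$ is the graph obtained from the star $K_{1,k}$ by adding one edge joining two of its leaves (so $F_2=K_3$). $K_4^-$ is $K_4$ with one edge removed. -}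

module Defs where

open import Data.Nat using (ℕ; zero; suc; _+_; _*_; _≤_; _<ᵇ_; _≡ᵇ_)
open import Data.Bool using (Bool; true; false; _∧_; _∨_; not; if_then_else_)
open import Data.Fin using (Fin; toℕ) renaming (zero to fzero; suc to fsuc)
open import Data.List using (List; map; allFin)
open import Data.Nat.ListAction using (sum)
open import Data.Product using (Σ; ∃; _×_; _,_; proj₁; proj₂)
open import Data.Sum using (_⊎_)
open import Relation.Nullary using (¬_)
open import Relation.Binary.PropositionalEquality using (_≡_; _≢_)
open import Relation.Binary.Construct.Closure.ReflexiveTransitive using (Star)

record Graph (n : ℕ) : Set where
  field
    Adj    : Fin n → Fin n → Bool
    sym    : ∀ i j → Adj i j ≡ Adj j i
    irrefl : ∀ i → Adj i i ≡ false
open Graph public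

-- An edge {i,j} of G, represented canonically with toℕ i < toℕ j.
Edge : ∀ {n} → Graph n → Set
Edge {n} G = Σ (Fin n × Fin n) λ p →
  ((toℕ (proj₁ p) <ᵇ toℕ (proj₂ p)) ≡ true) × (Adj G (proj₁ p) (proj₂ p) ≡ true)

edgeCount : ∀ {n} → Graph n → ℕ
edgeCount {n} G = sum (map (λ i → sum (map (λ j →
  if (toℕ i <ᵇ toℕ j) ∧ Adj G i j then 1 else 0) (allFin n))) (allFin n))

SharesEndpoint : ∀ {n} {G : Graph n} → Edge G → Edge G → Set
SharesEndpoint ((i , j) , _) ((k , l) , _) = (i ≡ k ⊎ i ≡ l) ⊎ (j ≡ k ⊎ j ≡ l)

CoAdj : ∀ {n} {G : Graph n} → Edge G → Edge G → Set
CoAdj {G = G} e e' = ¬ SharesEndpoint {G = G} e e'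

Reach : ∀ {V : Set} → (V → V → Set) → V → V → Set
Reach R = Star R

Disconnected : ∀ {V : Set} → (V → V → Set) → Set
Disconnected {V} R = Σ V λ x → Σ V λ y → ¬ Reach R x y

ComponentCount : ∀ {V : Set} → (V → V → Set) → ℕ → Set
ComponentCount {V} R k = Σ (V → Fin k) λ f →
  (∀ (a : Fin k) → Σ V λ x → f x ≡ a) ×
  (∀ x y → (f x ≡ f y → Reach R x y) × (Reach R x y → f x ≡ f y))

-- ρ(G) = |E(G)| + c(co(G)), with c the component count of co(G)
ρ : ∀ {n} → Graph n → ℕ → ℕ
ρ G c = edgeCount G + c

IsTypeA : ∀ {n} → Graph n → Set
IsTypeA G = Σ (Edge G) (λ e → ∀ (e' : Edge G) → SharesEndpoint {G = G} e e')
          × ComponentCount (CoAdj {G = G}) 2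

-- "G with isolated vertices removed is isomorphic to H" where H is given
-- by an adjacency function on Fin m: an injection f from the vertices of
-- H onto the non-isolated vertices of G preserving adjacency both ways.

NonIsolated : ∀ {n} → Graph n → Fin n → Set
NonIsolated {n} G v = Σ (Fin n) λ w → Adj G v w ≡ true

record CoreIso {n m : ℕ} (G : Graph n) (H : Fin m → Fin m → Bool) : Set where
  field
    f        : Fin m → Fin n
    f-inj    : ∀ i j → f i ≡ f j → i ≡ j
    f-into   : ∀ i → NonIsolated G (f i)
    f-onto   : ∀ v → NonIsolated G v → Σ (Fin m) λ i → f i ≡ v
    f-adj    : ∀ i j → H i j ≡ Adj G (f i) (f j)

starAdj : ∀ λ′ → Fin (suc λ′) → Fin (suc λ′) → Bool
starAdj _ fzero    fzero    = false
starAdj _ fzero    (fsuc _) = true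
starAdj _ (fsuc _) fzero    = true
starAdj _ (fsuc _) (fsuc _) = false

-- F_k on Fin (suc k): star K_{1,k} with centre 0, plus the edge {1,2}
fAdj : ∀ k → Fin (suc k) → Fin (suc k) → Bool
fAdj _ fzero    fzero    = false
fAdj _ fzero    (fsuc _) = true
fAdj _ (fsuc _) fzero    = true
fAdj _ (fsuc i) (fsuc j) =
  ((toℕ i ≡ᵇ 0) ∧ (toℕ j ≡ᵇ 1)) ∨ ((toℕ i ≡ᵇ 1) ∧ (toℕ j ≡ᵇ 0))

c4Next : ℕ → ℕ → Bool
c4Next a b = (suc a ≡ᵇ b) ∨ ((a ≡ᵇ 3) ∧ (b ≡ᵇ 0))

c4Adj : Fin 4 → Fin 4 → Bool
c4Adj i j = c4Next (toℕ i) (toℕ j) ∨ c4Next (toℕ j) (toℕ i)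

k4Adj : Fin 4 → Fin 4 → Bool
k4Adj i j = not (toℕ i ≡ᵇ toℕ j)

k4mAdj : Fin 4 → Fin 4 → Bool
k4mAdj i j = k4Adj i j ∧ not (((toℕ i ≡ᵇ 0) ∧ (toℕ j ≡ᵇ 1)) ∨ ((toℕ i ≡ᵇ 1) ∧ (toℕ j ≡ᵇ 0)))

-- Label every edge by its component in co(G). Disjoint edges are adjacent in co(G), so two
-- edges with different labels share an endpoint.
--
-- Three labels: three such edges form a claw or a triangle. A claw without a chord forces every
-- edge through its centre, so G is a star in which each edge is its own component. Otherwise
-- there is a triangle with three labels; every edge meets it, its sides carry all labels, and an
-- edge from a corner to an outside vertex lies in the component of the opposite side. Hence two
-- corners with outside neighbours share the same one t, and G is K₄ or K₄⁻ on the triangle and t;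
-- if at most one corner has outside neighbours, G is F_k.
--
-- Two labels: take edges va, vb in different components. If one of them meets every edge, G is of
-- type A. Otherwise an edge missing {v, a} and one missing {v, b} close a 4-cycle v a w b whose
-- opposite sides share a component; a diagonal would form a third component, so G is C₄.
--
-- The edge counts are read off the isomorphism by counting ordered pairs of adjacent vertices.

module Submission where

open import Defs hiding (sym)
open import Axiom.UniquenessOfIdentityProofs.WithK using (uip)
open import Data.Bool using (Bool; true; false; _∧_; if_then_else_)
open import Data.Bool.Properties using (∧-zeroʳ; ∧-identityʳ; ¬-not)
import Data.Bool.Properties as Bool
open import Data.Empty using (⊥-elim)
open import Data.Fin using (Fin; zero; suc; toℕ)
open import Data.Fin.Patterns using (0F; 1F; 2F; 3F)
open import Data.Fin.Properties
  using (_≟_; any?; suc-injective; toℕ-injective; cantor-schröder-bernstein; injective⇒≤)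
open import Data.List using (List; []; _∷_; map; allFin; tabulate; length; lookup; filter)
open import Data.List.Membership.Propositional using (_∈_)
open import Data.List.Membership.Propositional.Properties using (∈-lookup; ∈-filter⁺; ∈-filter⁻; ∈-tabulate⁺)
open import Data.List.Properties using (map-tabulate)
open import Data.List.Relation.Unary.All as All using (All; []; _∷_)
open import Data.List.Relation.Unary.AllPairs using ([]; _∷_)
open import Data.List.Relation.Unary.Any using (here; there; index)
open import Data.List.Relation.Unary.Any.Properties using (lookup-index)
open import Data.List.Relation.Unary.Unique.Propositional using (Unique)
open import Data.List.Relation.Unary.Unique.Propositional.Properties using (filter⁺; allFin⁺)
open import Data.Nat using (ℕ; zero; suc; _+_; _*_; _≤_; z≤n; s≤s; _<ᵇ_)
open import Data.Nat.ListAction using (sum)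
open import Data.Nat.Properties using (+-0-commutativeMonoid; +-identityʳ; +-suc; *-cancelˡ-≡)
open import Data.Nat.Tactic.RingSolver using (solve-∀)
open import Data.Product using (Σ; ∃; _×_; _,_; proj₁; proj₂)
open import Data.Sum using (_⊎_; inj₁; inj₂; swap; [_,_])
open import Function using (_∘_; id; flip)
open import Relation.Binary.Construct.Closure.ReflexiveTransitive using (ε; _◅_)
open import Relation.Binary.PropositionalEquality hiding ([_])
open import Relation.Nullary using (¬_; Dec; yes; no; does; contradiction)
open import Relation.Nullary.Decidable
  using (recompute; _×-dec_; _⊎-dec_; ¬?; decidable-stable; dec-true; dec-false)
open import Relation.Unary using (Decidable)
open import Algebra.Properties.CommutativeMonoid.Sum +-0-commutativeMonoid
  using (sum-syntax; ∑-comm; ∑-distrib-+; sum-cong-≗; sum-replicate-zero)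
  renaming (sum to ∑)

𝟙 : Bool → ℕ
𝟙 b = if b then 1 else 0

∑-zero : ∀ {n} (h : Fin n → ℕ) → (∀ i → h i ≡ 0) → ∑ h ≡ 0
∑-zero {n} h h≗0 = trans (sum-cong-≗ h≗0) (sum-replicate-zero n)

∑-single : ∀ {n} (u : Fin n) (h : Fin n → ℕ) → (∀ v → v ≢ u → h v ≡ 0) → ∑ h ≡ h u
∑-single zero    h off = trans (cong (h zero +_) (∑-zero (h ∘ suc) (λ v → off (suc v) λ ())))
                               (+-identityʳ (h zero))
∑-single (suc u) h off = cong₂ _+_ (off zero λ ())
                               (∑-single u (h ∘ suc) (λ v v≢u → off (suc v) (v≢u ∘ suc-injective)))

sum-tabulate : ∀ {n} (g : Fin n → ℕ) → sum (tabulate g) ≡ ∑ g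
sum-tabulate {zero}  g = refl
sum-tabulate {suc n} g = cong (g zero +_) (sum-tabulate (g ∘ suc))

sum-allFin : ∀ {n} (g : Fin n → ℕ) → sum (map g (allFin n)) ≡ ∑ g
sum-allFin g = trans (cong sum (map-tabulate (λ i → i) g)) (sum-tabulate g)

module _ {m n} (f : Fin m → Fin n) (f-inj : ∀ i j → f i ≡ f j → i ≡ j) where

  private
    δ : Fin n → Fin n → ℕ → ℕ
    δ u v x = if does (u ≟ v) then x else 0

    δ-off : ∀ {u v} x → u ≢ v → δ u v x ≡ 0
    δ-off {u} {v} x u≢v rewrite dec-false (u ≟ v) u≢v = refl

    δ-on : ∀ u x → δ u u x ≡ x
    δ-on u x rewrite dec-true (u ≟ u) refl = refl

    fibre : (g : Fin n → ℕ) → (∀ v → (∀ k → f k ≢ v) → g v ≡ 0) →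
            ∀ v → g v ≡ ∑[ k < m ] δ (f k) v (g v)
    fibre g off v with any? (λ k → f k ≟ v)
    ... | yes (k₀ , refl) = sym (trans (∑-single k₀ _ λ k k≢k₀ → δ-off _ (k≢k₀ ∘ f-inj k k₀))
                                       (δ-on (f k₀) _))
    ... | no v∉f = trans (off v v∉f′) (sym (∑-zero _ λ k → δ-off _ (v∉f′ k)))
      where
      v∉f′ : ∀ k → f k ≢ v
      v∉f′ k fk≡v = v∉f (k , fk≡v)

  -- Double counting through the fibres of f.
  ∑-reindex : (g : Fin n → ℕ) → (∀ v → (∀ k → f k ≢ v) → g v ≡ 0) → ∑ g ≡ ∑ (g ∘ f)
  ∑-reindex g off = begin
    ∑[ v < n ] g v                       ≡⟨ sum-cong-≗ (fibre g off) ⟩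
    ∑[ v < n ] ∑[ k < m ] δ (f k) v (g v) ≡⟨ ∑-comm (λ v k → δ (f k) v (g v)) ⟩
    ∑[ k < m ] ∑[ v < n ] δ (f k) v (g v) ≡⟨ sum-cong-≗ (λ k → ∑-single (f k) _ λ v v≢fk →
                                                                     δ-off _ (v≢fk ∘ sym)) ⟩
    ∑[ k < m ] δ (f k) (f k) (g (f k))    ≡⟨ sum-cong-≗ (λ k → δ-on (f k) _) ⟩
    ∑[ k < m ] g (f k)                   ∎
    where open ≡-Reasoning

lookup-injective : ∀ {A : Set} {xs : List A} → Unique xs → ∀ i j → lookup xs i ≡ lookup xs j → i ≡ j
lookup-injective (_ ∷ _)      zero    zero    _  = refl
lookup-injective (x∉xs ∷ _)   zero    (suc j) eq = contradiction eq (All.lookup x∉xs (∈-lookup j))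
lookup-injective (x∉xs ∷ _)   (suc i) zero    eq = contradiction (sym eq) (All.lookup x∉xs (∈-lookup i))
lookup-injective (_ ∷ unique) (suc i) (suc j) eq = cong suc (lookup-injective unique i j eq)

module _ {n} {P : Fin n → Set} (P? : Decidable P) where

  select : List (Fin n)
  select = filter P? (allFin n)

  ∈-select⁺ : ∀ {t} → P t → t ∈ select
  ∈-select⁺ {t} = ∈-filter⁺ P? (∈-tabulate⁺ t)

  ∈-select⁻ : ∀ {t} → t ∈ select → P t
  ∈-select⁻ = proj₂ ∘ ∈-filter⁻ P? {xs = allFin n}

  select-unique : Unique select
  select-unique = filter⁺ P? (allFin⁺ n)

bijection⇒≡ : ∀ {m k} (f : Fin m → Fin k) → (∀ i j → f i ≡ f j → i ≡ j) →
              (∀ y → Σ (Fin m) λ x → f x ≡ y) → m ≡ k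
bijection⇒≡ f f-inj f-onto = cantor-schröder-bernstein {f = f} {g = proj₁ ∘ f-onto}
  (f-inj _ _) (λ {y} {y′} eq → trans (sym (proj₂ (f-onto y))) (trans (cong f eq) (proj₂ (f-onto y′))))

unique-cover⇒length : ∀ {k} (xs : List (Fin k)) → Unique xs → (∀ y → y ∈ xs) → length xs ≡ k
unique-cover⇒length xs unique covers =
  bijection⇒≡ (lookup xs) (lookup-injective unique) (λ y → index (covers y) , sym (lookup-index (covers y)))

unique⇒length≤ : ∀ {k} (xs : List (Fin k)) → Unique xs → length xs ≤ k
unique⇒length≤ xs unique = injective⇒≤ (lookup-injective unique _ _)

<ᵇ-flip : ∀ a b → (a <ᵇ b) ≡ false → a ≢ b → (b <ᵇ a) ≡ true
<ᵇ-flip zero    zero    _ a≢b = contradiction refl a≢b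
<ᵇ-flip (suc a) zero    _ _   = refl
<ᵇ-flip (suc a) (suc b) p a≢b = <ᵇ-flip a b p (a≢b ∘ cong suc)

<ᵇ-asym : ∀ a b → (a <ᵇ b) ≡ true → (b <ᵇ a) ≢ true
<ᵇ-asym (suc a) (suc b) p q = <ᵇ-asym a b p q

arcCount : ∀ {m} → (Fin m → Fin m → Bool) → ℕ
arcCount {m} H = ∑[ i < m ] ∑[ j < m ] 𝟙 (H i j)

∑-ones : ∀ l → ∑[ i < l ] 1 ≡ l
∑-ones zero    = refl
∑-ones (suc l) = cong suc (∑-ones l)

starAdj-arcs : ∀ l → arcCount (starAdj l) ≡ 2 * l
starAdj-arcs l = begin
  arcCount (starAdj l)                   ≡⟨ cong₂ _+_ (∑-ones l)
                                              (sum-cong-≗ {l} λ _ → cong suc (sum-replicate-zero l)) ⟩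
  l + ∑[ i < l ] 1                       ≡⟨ cong (l +_) (trans (∑-ones l) (sym (+-identityʳ l))) ⟩
  2 * l                                  ∎
  where open ≡-Reasoning

-- Row by row: 2 + m from the centre, 2 from each end of the extra edge, 1 from every other leaf.
fAdj-arcs : ∀ m → arcCount (fAdj (2 + m)) ≡ 2 * (3 + m)
fAdj-arcs m = begin
  arcCount (fAdj (2 + m))                ≡⟨ cong₂ _+_ (∑-ones (2 + m)) (cong₂ _+_ (cong (2 +_) (sum-replicate-zero m))
                                              (cong₂ _+_ (cong (2 +_) (sum-replicate-zero m))
                                                (sum-cong-≗ {m} λ _ → cong suc (sum-replicate-zero (2 + m))))) ⟩
  (2 + m) + (2 + (2 + ∑[ i < m ] 1))     ≡⟨ cong (λ k → (2 + m) + (4 + k)) (∑-ones m) ⟩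
  (2 + m) + (4 + m)                      ≡⟨ arith m ⟩
  2 * (3 + m)                            ∎
  where
  open ≡-Reasoning
  arith : ∀ m → (2 + m) + (4 + m) ≡ 2 * (3 + m)
  arith = solve-∀

Classification : ∀ {n} → Graph n → ℕ → Set
Classification G c =
    (Σ ℕ λ l → 1 ≤ l × CoreIso G (starAdj l) × c ≡ l × ρ G c ≡ 2 * l)
    ⊎ (IsTypeA G × c ≡ 2 × ρ G c ≡ edgeCount G + 2)
    ⊎ (CoreIso G c4Adj × c ≡ 2 × ρ G c ≡ 6)
    ⊎ (Σ ℕ λ k → 2 ≤ k × CoreIso G (fAdj k) × c ≡ 3 × ρ G c ≡ k + 4)
    ⊎ (CoreIso G k4mAdj × c ≡ 3 × ρ G c ≡ 8)
    ⊎ (CoreIso G k4Adj × c ≡ 3 × ρ G c ≡ 9)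

module GraphProperties {n} (G : Graph n) where

  infix 4 _~_
  _~_ : Fin n → Fin n → Set
  x ~ y = Adj G x y ≡ true

  _~?_ : ∀ x y → Dec (x ~ y)
  x ~? y = Adj G x y Bool.≟ true

  ~-sym : ∀ {x y} → x ~ y → y ~ x
  ~-sym {x} {y} p = trans (Graph.sym G y x) p

  ~-irrefl : ∀ {x y} → x ~ y → x ≢ y
  ~-irrefl {x} p refl with trans (sym p) (irrefl G x)
  ... | ()

  ≁⇒false : ∀ {x y} → ¬ x ~ y → Adj G x y ≡ false
  ≁⇒false = ¬-not

  Endpoint : Fin n → Fin n → Fin n → Set
  Endpoint z x y = z ≡ x ⊎ z ≡ y

  _∈ₑ_ : Fin n → Edge G → Set
  z ∈ₑ ((x , y) , _) = Endpoint z x y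

  private
    orient : ∀ {x y} → x ~ y → (b : Bool) → (toℕ x <ᵇ toℕ y) ≡ b → Edge G
    orient {x} {y} p true  x<y = (x , y) , x<y , p
    orient {x} {y} p false x≮y = (y , x) , <ᵇ-flip _ _ x≮y (~-irrefl p ∘ toℕ-injective) , ~-sym p

    ∈-orient⁻ : ∀ {x y z} (p : x ~ y) b eq → z ∈ₑ orient p b eq → Endpoint z x y
    ∈-orient⁻ p true  _ = λ z∈ → z∈
    ∈-orient⁻ p false _ = swap

    ∈-orient⁺ : ∀ {x y z} (p : x ~ y) b eq → Endpoint z x y → z ∈ₑ orient p b eq
    ∈-orient⁺ p true  _ = λ z∈ → z∈
    ∈-orient⁺ p false _ = swap

  -- Irrelevance in the adjacency proof makes edge p, and hence its component label, depend only
  -- on the endpoints.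
  edge : ∀ {x y} → .(x ~ y) → Edge G
  edge {x} {y} p = orient (recompute (x ~? y) p) (toℕ x <ᵇ toℕ y) refl

  ∈-edge⁻ : ∀ {x y z} .(p : x ~ y) → z ∈ₑ edge p → Endpoint z x y
  ∈-edge⁻ {x} {y} p = ∈-orient⁻ (recompute (x ~? y) p) (toℕ x <ᵇ toℕ y) refl

  ∈-edge⁺ : ∀ {x y z} .(p : x ~ y) → Endpoint z x y → z ∈ₑ edge p
  ∈-edge⁺ {x} {y} p = ∈-orient⁺ (recompute (x ~? y) p) (toℕ x <ᵇ toℕ y) refl

  edge-adj : (e : Edge G) → proj₁ (proj₁ e) ~ proj₂ (proj₁ e)
  edge-adj e = proj₂ (proj₂ e)

  edge-≡ : (e e′ : Edge G) → (∀ z → z ∈ₑ e → z ∈ₑ e′) → e ≡ e′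
  edge-≡ e@((x , y) , x<y , p) ((u , w) , u<w , q) e⊆e′
    with e⊆e′ x (inj₁ refl) | e⊆e′ y (inj₂ refl)
  ... | inj₁ refl | inj₁ refl = contradiction refl (~-irrefl p)
  ... | inj₁ refl | inj₂ refl = cong₂ (λ a b → (x , y) , a , b) (uip x<y u<w) (uip p q)
  ... | inj₂ refl | inj₁ refl = contradiction u<w (<ᵇ-asym (toℕ x) (toℕ y) x<y)
  ... | inj₂ refl | inj₂ refl = contradiction refl (~-irrefl p)

  edge-η : (e : Edge G) → edge (edge-adj e) ≡ e
  edge-η e = edge-≡ _ e (λ z → ∈-edge⁻ (edge-adj e))

  edge-sym : ∀ {x y} (p : x ~ y) → edge p ≡ edge (~-sym p)
  edge-sym p = edge-≡ _ _ (λ z → ∈-edge⁺ (~-sym p) ∘ swap ∘ ∈-edge⁻ p)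

  Meets : Fin n → Fin n → Fin n → Fin n → Set
  Meets x y u w = Endpoint x u w ⊎ Endpoint y u w

  meets? : ∀ x y u w → Dec (Meets x y u w)
  meets? x y u w = ((x ≟ u) ⊎-dec (x ≟ w)) ⊎-dec ((y ≟ u) ⊎-dec (y ≟ w))

  meets-common : ∀ {x y u w} → Meets x y u w → Σ (Fin n) λ z → Endpoint z x y × Endpoint z u w
  meets-common {x} (inj₁ x∈uw) = x , inj₁ refl , x∈uw
  meets-common {y = y} (inj₂ y∈uw) = y , inj₂ refl , y∈uw

  common-meets : ∀ {x y u w z} → Endpoint z x y → Endpoint z u w → Meets x y u w
  common-meets (inj₁ refl) z∈uw = inj₁ z∈uw
  common-meets (inj₂ refl) z∈uw = inj₂ z∈uw

  shares⇒meets : ∀ {x y u w} .(p : x ~ y) .(q : u ~ w) → SharesEndpoint {G = G} (edge p) (edge q) → Meets x y u w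
  shares⇒meets p q shared with meets-common shared
  ... | z , z∈p , z∈q = common-meets (∈-edge⁻ p z∈p) (∈-edge⁻ q z∈q)

  coadj-avoids : ∀ {e e′ z} → CoAdj {G = G} e e′ → z ∈ₑ e → ¬ z ∈ₑ e′
  coadj-avoids coadj z∈e z∈e′ = coadj (common-meets z∈e z∈e′)

  spans : ∀ {x y} (e : Edge G) → Endpoint (proj₁ (proj₁ e)) x y → Endpoint (proj₂ (proj₁ e)) x y →
          x ∈ₑ e × y ∈ₑ e
  spans e (inj₁ e₁≡x) (inj₁ e₂≡x) = contradiction (trans e₁≡x (sym e₂≡x)) (~-irrefl (edge-adj e))
  spans e (inj₁ e₁≡x) (inj₂ e₂≡y) = inj₁ (sym e₁≡x) , inj₂ (sym e₂≡y)
  spans e (inj₂ e₁≡y) (inj₁ e₂≡x) = inj₂ (sym e₂≡x) , inj₁ (sym e₁≡y)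
  spans e (inj₂ e₁≡y) (inj₂ e₂≡y) = contradiction (trans e₁≡y (sym e₂≡y)) (~-irrefl (edge-adj e))

  meets-away-from : ∀ {x y v t} → x ≢ v → y ≢ v → Meets x y v t → x ≡ t ⊎ y ≡ t
  meets-away-from x≢v y≢v = [ [ flip contradiction x≢v , inj₁ ] , [ flip contradiction y≢v , inj₂ ] ]

  meets-both : ∀ {u u′ p q r s} → Meets u u′ p q → Meets u u′ r s → ¬ Meets p q r s →
               Endpoint u p q ⊎ Endpoint u r s
  meets-both (inj₁ u∈pq)  _            _      = inj₁ u∈pq
  meets-both (inj₂ _)     (inj₁ u∈rs)  _      = inj₂ u∈rs
  meets-both (inj₂ u′∈pq) (inj₂ u′∈rs) pq∌rs = contradiction (common-meets u′∈pq u′∈rs) pq∌rs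

  Avoiding : Fin n → Fin n → Set
  Avoiding v a = Σ (Fin n) λ x → Σ (Fin n) λ y → x ~ y × ¬ Meets x y v a

  avoiding? : ∀ v a → Dec (Avoiding v a)
  avoiding? v a = any? λ x → any? λ y → (x ~? y) ×-dec ¬? (meets? x y v a)

  ¬avoiding⇒dominated : ∀ {v a} → ¬ Avoiding v a → ∀ x y → x ~ y → Meets x y v a
  ¬avoiding⇒dominated none x y xy = decidable-stable (meets? x y _ _) λ x∌va → none (x , y , xy , x∌va)

  NeighbourOutside : Fin n → Fin n → Fin n → Fin n → Set
  NeighbourOutside x y z t = x ~ t × t ≢ y × t ≢ z

  neighbourOutside? : ∀ x y z → Decidable (NeighbourOutside x y z)
  neighbourOutside? x y z t = (x ~? t) ×-dec (¬? (t ≟ y) ×-dec ¬? (t ≟ z))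

  edgeCount≡∑ : edgeCount G ≡ ∑[ i < n ] ∑[ j < n ] 𝟙 ((toℕ i <ᵇ toℕ j) ∧ Adj G i j)
  edgeCount≡∑ =
    trans (sum-allFin {n} _) (sum-cong-≗ λ i → sum-allFin {n} (λ j → 𝟙 ((toℕ i <ᵇ toℕ j) ∧ Adj G i j)))

  handshake : 2 * edgeCount G ≡ arcCount (Adj G)
  handshake = begin
    2 * edgeCount G                    ≡⟨ cong (2 *_) edgeCount≡∑ ⟩
    2 * E                              ≡⟨ cong (E +_) (+-identityʳ E) ⟩
    E + E                              ≡⟨ cong (E +_) (∑-comm h) ⟩
    E + ∑[ i < n ] ∑[ j < n ] h j i    ≡⟨ ∑-distrib-+ (λ i → ∑[ j < n ] h i j) _ ⟨
    ∑[ i < n ] (∑[ j < n ] h i j + ∑[ j < n ] h j i)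
                                       ≡⟨ sum-cong-≗ (λ i → ∑-distrib-+ (h i) (λ j → h j i)) ⟨
    ∑[ i < n ] ∑[ j < n ] (h i j + h j i)
                                       ≡⟨ sum-cong-≗ (λ i → sum-cong-≗ (arc-split i)) ⟨
    arcCount (Adj G)                   ∎
    where
    open ≡-Reasoning
    h : Fin n → Fin n → ℕ
    h i j = 𝟙 ((toℕ i <ᵇ toℕ j) ∧ Adj G i j)
    E : ℕ
    E = ∑[ i < n ] ∑[ j < n ] h i j
    arc-split : ∀ i j → 𝟙 (Adj G i j) ≡ h i j + h j i
    arc-split i j rewrite Graph.sym G j i with Adj G i j in p
    ... | false rewrite ∧-zeroʳ (toℕ i <ᵇ toℕ j) | ∧-zeroʳ (toℕ j <ᵇ toℕ i) = refl
    ... | true  rewrite ∧-identityʳ (toℕ i <ᵇ toℕ j) | ∧-identityʳ (toℕ j <ᵇ toℕ i)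
      with toℕ i <ᵇ toℕ j in i<j
    ...   | true  rewrite ¬-not (<ᵇ-asym (toℕ i) (toℕ j) i<j) = refl
    ...   | false rewrite <ᵇ-flip _ _ i<j (~-irrefl p ∘ toℕ-injective) = refl

  arcCount-iso : ∀ {m} {H : Fin m → Fin m → Bool} → CoreIso G H → arcCount (Adj G) ≡ arcCount H
  arcCount-iso {m} {H} iso = begin
    ∑[ u < n ] ∑[ w < n ] 𝟙 (Adj G u w)
      ≡⟨ ∑-reindex f f-inj _ (λ u u∉f → ∑-zero _ λ w → cong 𝟙 (isolated u∉f w)) ⟩
    ∑[ i < m ] ∑[ w < n ] 𝟙 (Adj G (f i) w)
      ≡⟨ sum-cong-≗ (λ i → ∑-reindex f f-inj _ λ w w∉f →
                             cong 𝟙 (trans (Graph.sym G (f i) w) (isolated w∉f (f i)))) ⟩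
    ∑[ i < m ] ∑[ j < m ] 𝟙 (Adj G (f i) (f j))
      ≡⟨ sum-cong-≗ (λ i → sum-cong-≗ λ j → cong 𝟙 (f-adj i j)) ⟨
    arcCount H                              ∎
    where
    open ≡-Reasoning
    open CoreIso iso
    isolated : ∀ {u} → (∀ i → f i ≢ u) → ∀ w → Adj G u w ≡ false
    isolated u∉f w = ≁⇒false λ p → u∉f (proj₁ (f-onto _ (w , p))) (proj₂ (f-onto _ (w , p)))

  edgeCount-iso : ∀ {m k} {H : Fin m → Fin m → Bool} → CoreIso G H → arcCount H ≡ 2 * k → edgeCount G ≡ k
  edgeCount-iso {k = k} iso arcs = *-cancelˡ-≡ (edgeCount G) k 2 (trans handshake (trans (arcCount-iso iso) arcs))

  core-iso : (xs : List (Fin n)) → Unique xs →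
             {H : Fin (length xs) → Fin (length xs) → Bool} →
             (∀ i j → H i j ≡ Adj G (lookup xs i) (lookup xs j)) →
             All (NonIsolated G) xs → (∀ u w → u ~ w → u ∈ xs) → CoreIso G H
  core-iso xs unique adj non-isolated covers = record
    { f      = lookup xs
    ; f-inj  = lookup-injective unique
    ; f-into = λ i → All.lookup non-isolated (∈-lookup i)
    ; f-onto = λ u (w , u~w) → index (covers u w u~w) , sym (lookup-index (covers u w u~w))
    ; f-adj  = adj
    }

  typeA-case : ∀ {x y c} (p : x ~ y) → (∀ u w → u ~ w → Meets u w x y) →
               ComponentCount (CoAdj {G = G}) c → c ≡ 2 → Classification G c
  typeA-case p dominating cc refl = inj₂ (inj₁ (((edge p , shares) , cc) , refl , refl))
    where
    shares : ∀ e → SharesEndpoint {G = G} (edge p) e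
    shares e with meets-common (dominating _ _ (edge-adj e))
    ... | z , z∈e , z∈p = common-meets (∈-edge⁺ p z∈p) z∈e

  star-case : ∀ {c l} → 1 ≤ l → CoreIso G (starAdj l) → c ≡ l → Classification G c
  star-case {l = l} 1≤l iso refl = inj₁ (l , 1≤l , iso , refl , ρ≡2l)
    where
    open ≡-Reasoning
    ρ≡2l : ρ G l ≡ 2 * l
    ρ≡2l = begin
      edgeCount G + l  ≡⟨ cong (_+ l) (edgeCount-iso iso (starAdj-arcs l)) ⟩
      l + l            ≡⟨ cong (l +_) (+-identityʳ l) ⟨
      2 * l            ∎

  c4-case : ∀ {c} → CoreIso G c4Adj → c ≡ 2 → Classification G c
  c4-case iso refl = inj₂ (inj₂ (inj₁ (iso , refl , cong (_+ 2) (edgeCount-iso {k = 4} iso refl))))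

  f-case : ∀ {c m} → CoreIso G (fAdj (2 + m)) → c ≡ 3 → Classification G c
  f-case {m = m} iso refl = inj₂ (inj₂ (inj₂ (inj₁ (2 + m , s≤s (s≤s z≤n) , iso , refl , ρ≡k+4))))
    where
    open ≡-Reasoning
    ρ≡k+4 : ρ G 3 ≡ (2 + m) + 4
    ρ≡k+4 = begin
      edgeCount G + 3  ≡⟨ cong (_+ 3) (edgeCount-iso {k = 3 + m} iso (fAdj-arcs m)) ⟩
      (3 + m) + 3      ≡⟨ cong (2 +_) (+-suc m 3) ⟨
      (2 + m) + 4      ∎

  k4⁻-case : ∀ {c} → CoreIso G k4mAdj → c ≡ 3 → Classification G c
  k4⁻-case iso refl = inj₂ (inj₂ (inj₂ (inj₂ (inj₁ (iso , refl , cong (_+ 3) (edgeCount-iso {k = 5} iso refl))))))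

  k4-case : ∀ {c} → CoreIso G k4Adj → c ≡ 3 → Classification G c
  k4-case iso refl = inj₂ (inj₂ (inj₂ (inj₂ (inj₂ (iso , refl , cong (_+ 3) (edgeCount-iso {k = 6} iso refl))))))

module Components {n} (G : Graph n) {c} (cc : ComponentCount (CoAdj {G = G}) c) where
  open GraphProperties G

  private
    label : Edge G → Fin c
    label = proj₁ cc

  ℓ : ∀ {x y} → .(x ~ y) → Fin c
  ℓ p = label (edge p)

  ℓ-cong : ∀ {x y y′} (p : x ~ y) (q : x ~ y′) → y ≡ y′ → ℓ p ≡ ℓ q
  ℓ-cong p q refl = refl

  ℓ-sym : ∀ {x y} (p : x ~ y) → ℓ p ≡ ℓ (~-sym p)
  ℓ-sym p = cong label (edge-sym p)

  label≡ℓ : (e : Edge G) → label e ≡ ℓ (edge-adj e)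
  label≡ℓ e = cong label (sym (edge-η e))

  ℓ-onto : ∀ k → Σ (Fin n) λ x → Σ (Fin n) λ y → Σ (x ~ y) λ p → ℓ p ≡ k
  ℓ-onto k with proj₁ (proj₂ cc) k
  ... | e , e↦k = _ , _ , edge-adj e , trans (sym (label≡ℓ e)) e↦k

  ℓ-reach : ∀ {x y u w} (p : x ~ y) (q : u ~ w) → ℓ p ≡ ℓ q → Reach (CoAdj {G = G}) (edge p) (edge q)
  ℓ-reach p q = proj₁ (proj₂ (proj₂ cc) (edge p) (edge q))

  ℓ-disjoint : ∀ {x y u w} (p : x ~ y) (q : u ~ w) → ¬ Meets x y u w → ℓ p ≡ ℓ q
  ℓ-disjoint p q disjoint = proj₂ (proj₂ (proj₂ cc) (edge p) (edge q)) ((disjoint ∘ shares⇒meets p q) ◅ ε)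

  ℓ-meets : ∀ {x y u w} (p : x ~ y) (q : u ~ w) → ℓ p ≢ ℓ q → Meets x y u w
  ℓ-meets p q ℓp≢ℓq = decidable-stable (meets? _ _ _ _) (ℓp≢ℓq ∘ ℓ-disjoint p q)

  unreachable⇒ℓ≢ : ∀ {e e′} → ¬ Reach (CoAdj {G = G}) e e′ → ℓ (edge-adj e) ≢ ℓ (edge-adj e′)
  unreachable⇒ℓ≢ {e} {e′} e↛e′ eq =
    e↛e′ (subst₂ (Reach (CoAdj {G = G})) (edge-η e) (edge-η e′) (ℓ-reach (edge-adj e) (edge-adj e′) eq))

  at-endpoint : ∀ {v x y} (xy : x ~ y) → Endpoint v x y → Σ (Fin n) λ a → Σ (v ~ a) λ va → ℓ va ≡ ℓ xy
  at-endpoint xy (inj₁ refl) = _ , xy , refl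
  at-endpoint xy (inj₂ refl) = _ , ~-sym xy , sym (ℓ-sym xy)

  record Fork (k₀ k₁ : Fin c) : Set where
    constructor fork-at
    field
      {v a b} : Fin n
      va      : v ~ a
      vb      : v ~ b
      ℓva     : ℓ va ≡ k₀
      ℓvb     : ℓ vb ≡ k₁

  fork : ∀ {x y u w} (p : x ~ y) (q : u ~ w) → ℓ p ≢ ℓ q → Fork (ℓ p) (ℓ q)
  fork p q ℓp≢ℓq with meets-common (ℓ-meets p q ℓp≢ℓq)
  ... | v , v∈p , v∈q with at-endpoint p v∈p | at-endpoint q v∈q
  ...   | _ , va , ℓva | _ , vb , ℓvb = fork-at va vb ℓva ℓvb

  -- Three or more components

  module Star (v : Fin n) (centre : ∀ {x y} → x ~ y → Endpoint v x y) {a} (v~a : v ~ a) where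

    N : List (Fin n)
    N = select (v ~?_)

    v~N : ∀ i → v ~ lookup N i
    v~N i = ∈-select⁻ (v ~?_) (∈-lookup i)

    star-adj : ∀ i j → starAdj (length N) i j ≡ Adj G (lookup (v ∷ N) i) (lookup (v ∷ N) j)
    star-adj zero    zero    = sym (irrefl G v)
    star-adj zero    (suc j) = sym (v~N j)
    star-adj (suc i) zero    = sym (~-sym (v~N i))
    star-adj (suc i) (suc j) = sym (≁⇒false λ p → [ ~-irrefl (v~N i) , ~-irrefl (v~N j) ] (centre p))

    covers : ∀ u w → u ~ w → u ∈ v ∷ N
    covers u w u~w with centre u~w
    ... | inj₁ refl = here refl
    ... | inj₂ refl = there (∈-select⁺ (v ~?_) (~-sym u~w))

    iso : CoreIso G (starAdj (length N))
    iso = core-iso (v ∷ N) (All.tabulate (λ t∈N → ~-irrefl (∈-select⁻ (v ~?_) t∈N)) ∷ select-unique (v ~?_))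
            star-adj ((a , v~a) ∷ All.tabulate (λ t∈N → v , ~-sym (∈-select⁻ (v ~?_) t∈N))) covers

    -- No two edges are disjoint, so every component of co(G) is a single edge.
    reach⇒≡ : ∀ {e e′} → Reach (CoAdj {G = G}) e e′ → e ≡ e′
    reach⇒≡ ε = refl
    reach⇒≡ {e} (_◅_ {j = e′} coadj _) =
      contradiction (common-meets (centre (edge-adj e)) (centre (edge-adj e′))) coadj

    c≡|N| : c ≡ length N
    c≡|N| = sym (bijection⇒≡ (λ i → ℓ (v~N i)) injective onto)
      where
      injective : ∀ i j → ℓ (v~N i) ≡ ℓ (v~N j) → i ≡ j
      injective i j eq with ∈-edge⁻ (v~N j) (subst (lookup N i ∈ₑ_) (reach⇒≡ (ℓ-reach (v~N i) (v~N j) eq))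
                                                    (∈-edge⁺ (v~N i) (inj₂ refl)))
      ... | inj₁ Ni≡v = contradiction (sym Ni≡v) (~-irrefl (v~N i))
      ... | inj₂ Ni≡Nj = lookup-injective (select-unique (v ~?_)) i j Ni≡Nj
      onto : ∀ k → Σ (Fin (length N)) λ i → ℓ (v~N i) ≡ k
      onto k with ℓ-onto k
      ... | x , y , p , p↦k with centre p
      ...   | inj₁ refl = index y∈N , trans (ℓ-cong (v~N _) p (sym (lookup-index y∈N))) p↦k
        where
        y∈N : y ∈ N
        y∈N = ∈-select⁺ (v ~?_) p
      ...   | inj₂ refl = index x∈N , trans (ℓ-cong (v~N _) (~-sym p) (sym (lookup-index x∈N)))
                                              (trans (sym (ℓ-sym p)) p↦k)
        where
        x∈N : x ∈ N
        x∈N = ∈-select⁺ (v ~?_) (~-sym p)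

    classification : Classification G c
    classification = star-case (nonempty (∈-select⁺ (v ~?_) v~a)) iso c≡|N|
      where
      nonempty : ∀ {xs : List (Fin n)} → a ∈ xs → 1 ≤ length xs
      nonempty (here _)  = s≤s z≤n
      nonempty (there _) = s≤s z≤n

  module Triangle {x y z} (xy : x ~ y) (yz : y ~ z) (zx : z ~ x)
                  (xy≢yz : ℓ xy ≢ ℓ yz) (yz≢zx : ℓ yz ≢ ℓ zx) (zx≢xy : ℓ zx ≢ ℓ xy) where

    x≢y : x ≢ y
    x≢y = ~-irrefl xy

    y≢z : y ≢ z
    y≢z = ~-irrefl yz

    z≢x : z ≢ x
    z≢x = ~-irrefl zx

    InTriangle : Fin n → Set
    InTriangle t = t ≡ x ⊎ t ≡ y ⊎ t ≡ z

    -- A disjoint edge would share its label with both xy and yz.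
    meets-triangle : ∀ {u w} → u ~ w → InTriangle u ⊎ InTriangle w
    meets-triangle {u} {w} uw with in-triangle? u | in-triangle? w
      where
      in-triangle? : ∀ t → Dec (InTriangle t)
      in-triangle? t = (t ≟ x) ⊎-dec ((t ≟ y) ⊎-dec (t ≟ z))
    ... | yes u∈ | _      = inj₁ u∈
    ... | no _   | yes w∈ = inj₂ w∈
    ... | no u∉  | no w∉  = contradiction (trans (sym (ℓ-disjoint uw xy uw∌xy)) (ℓ-disjoint uw yz uw∌yz)) xy≢yz
      where
      uw∌xy : ¬ Meets u w x y
      uw∌xy = [ [ u∉ ∘ inj₁ , u∉ ∘ inj₂ ∘ inj₁ ] , [ w∉ ∘ inj₁ , w∉ ∘ inj₂ ∘ inj₁ ] ]
      uw∌yz : ¬ Meets u w y z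
      uw∌yz = [ [ u∉ ∘ inj₂ ∘ inj₁ , u∉ ∘ inj₂ ∘ inj₂ ] , [ w∉ ∘ inj₂ ∘ inj₁ , w∉ ∘ inj₂ ∘ inj₂ ] ]

    ℓ-pendant : ∀ {t} (xt : x ~ t) → t ≢ y → t ≢ z → ℓ xt ≡ ℓ yz
    ℓ-pendant xt t≢y t≢z = ℓ-disjoint xt yz [ [ x≢y , z≢x ∘ sym ] , [ t≢y , t≢z ] ]

    sides : List (Fin c)
    sides = ℓ xy ∷ ℓ yz ∷ ℓ zx ∷ []

    ℓ-at-x : ∀ {w} (xw : x ~ w) → ℓ xw ∈ sides
    ℓ-at-x {w} xw with w ≟ y | w ≟ z
    ... | yes refl | _        = here refl
    ... | no _     | yes refl = there (there (here (sym (ℓ-sym zx))))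
    ... | no w≢y   | no w≢z   = there (here (ℓ-pendant xw w≢y w≢z))

    pendants-coincide : ∀ {t s} → NeighbourOutside x y z t → NeighbourOutside y z x s → t ≡ s
    pendants-coincide (xt , t≢y , t≢z) (ys , s≢z , s≢x) =
      [ [ flip contradiction x≢y , flip contradiction s≢x ∘ sym ] , [ flip contradiction t≢y , id ] ]
        (ℓ-meets xt ys λ eq → yz≢zx (trans (sym (ℓ-pendant xt t≢y t≢z)) (trans eq ℓys≡ℓzx)))
      where
      ℓys≡ℓzx : ℓ ys ≡ ℓ zx
      ℓys≡ℓzx = ℓ-disjoint ys zx [ [ y≢z , x≢y ∘ sym ] , [ s≢z , s≢x ] ]

  module TriangleClassification {x y z} (xy : x ~ y) (yz : y ~ z) (zx : z ~ x)
                  (xy≢yz : ℓ xy ≢ ℓ yz) (yz≢zx : ℓ yz ≢ ℓ zx) (zx≢xy : ℓ zx ≢ ℓ xy) where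
    open Triangle xy yz zx xy≢yz yz≢zx zx≢xy
    private
      module R₁ = Triangle yz zx xy yz≢zx zx≢xy xy≢yz
      module R₂ = Triangle zx xy yz zx≢xy xy≢yz yz≢zx

    c≡3 : c ≡ 3
    c≡3 = sym (unique-cover⇒length sides ((xy≢yz ∷ zx≢xy ∘ sym ∷ []) ∷ (yz≢zx ∷ []) ∷ [] ∷ []) covered)
      where
      rotate : ∀ {a b d k : Fin c} → k ∈ b ∷ d ∷ a ∷ [] → k ∈ a ∷ b ∷ d ∷ []
      rotate (here k≡b)                 = there (here k≡b)
      rotate (there (here k≡d))         = there (there (here k≡d))
      rotate (there (there (here k≡a))) = here k≡a
      ℓ-at : ∀ {u w} (uw : u ~ w) → InTriangle u → ℓ uw ∈ sides
      ℓ-at uw (inj₁ refl)        = ℓ-at-x uw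
      ℓ-at uw (inj₂ (inj₁ refl)) = rotate (R₁.ℓ-at-x uw)
      ℓ-at uw (inj₂ (inj₂ refl)) = rotate (rotate (R₂.ℓ-at-x uw))
      covered : ∀ k → k ∈ sides
      covered k with ℓ-onto k
      ... | u , w , uw , refl with meets-triangle uw
      ...   | inj₁ u∈ = ℓ-at uw u∈
      ...   | inj₂ w∈ = subst (_∈ sides) (sym (ℓ-sym uw)) (ℓ-at (~-sym uw) w∈)

    -- y and z have no neighbours off the triangle, so G is the star at x plus the edge yz.
    module Fan (y-bare : ¬ ∃ (NeighbourOutside y z x)) (z-bare : ¬ ∃ (NeighbourOutside z x y)) where

      P : List (Fin n)
      P = select (neighbourOutside? x y z)

      P-nbr : ∀ {t} → t ∈ P → NeighbourOutside x y z t
      P-nbr = ∈-select⁻ (neighbourOutside? x y z)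

      P-outside : ∀ i → ¬ InTriangle (lookup P i)
      P-outside i with P-nbr (∈-lookup i)
      ... | xt , t≢y , t≢z = [ ~-irrefl xt ∘ sym , [ t≢y , t≢z ] ]

      y≁P : ∀ i → Adj G y (lookup P i) ≡ false
      y≁P i with P-nbr (∈-lookup i)
      ... | xt , _ , t≢z = ≁⇒false λ yt → y-bare (_ , yt , t≢z , ~-irrefl xt ∘ sym)

      z≁P : ∀ i → Adj G z (lookup P i) ≡ false
      z≁P i with P-nbr (∈-lookup i)
      ... | xt , t≢y , _ = ≁⇒false λ zt → z-bare (_ , zt , ~-irrefl xt ∘ sym , t≢y)

      P≁P : ∀ i j → Adj G (lookup P i) (lookup P j) ≡ false
      P≁P i j = ≁⇒false λ p → [ P-outside i , P-outside j ] (meets-triangle p)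

      fan-adj : ∀ i j → fAdj (2 + length P) i j ≡ Adj G (lookup (x ∷ y ∷ z ∷ P) i) (lookup (x ∷ y ∷ z ∷ P) j)
      fan-adj 0F                  0F                  = sym (irrefl G x)
      fan-adj 0F                  1F                  = sym xy
      fan-adj 0F                  2F                  = sym (~-sym zx)
      fan-adj 0F                  (suc (suc (suc j))) = sym (proj₁ (P-nbr (∈-lookup j)))
      fan-adj 1F                  0F                  = sym (~-sym xy)
      fan-adj 1F                  1F                  = sym (irrefl G y)
      fan-adj 1F                  2F                  = sym yz
      fan-adj 1F                  (suc (suc (suc j))) = sym (y≁P j)
      fan-adj 2F                  0F                  = sym zx
      fan-adj 2F                  1F                  = sym (~-sym yz)
      fan-adj 2F                  2F                  = sym (irrefl G z)
      fan-adj 2F                  (suc (suc (suc j))) = sym (z≁P j)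
      fan-adj (suc (suc (suc i))) 0F                  = sym (~-sym (proj₁ (P-nbr (∈-lookup i))))
      fan-adj (suc (suc (suc i))) 1F                  = sym (trans (Graph.sym G _ y) (y≁P i))
      fan-adj (suc (suc (suc i))) 2F                  = sym (trans (Graph.sym G _ z) (z≁P i))
      fan-adj (suc (suc (suc i))) (suc (suc (suc j))) = sym (P≁P i j)

      covers : ∀ u w → u ~ w → u ∈ x ∷ y ∷ z ∷ P
      covers u w uw with u ≟ x | u ≟ y | u ≟ z
      ... | yes refl | _        | _        = here refl
      ... | no _     | yes refl | _        = there (here refl)
      ... | no _     | no _     | yes refl = there (there (here refl))
      ... | no u≢x   | no u≢y   | no u≢z   with meets-triangle uw
      ...   | inj₁ u∈                 = contradiction u∈ [ u≢x , [ u≢y , u≢z ] ]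
      ...   | inj₂ (inj₁ refl)        = there (there (there (∈-select⁺ _ (~-sym uw , u≢y , u≢z))))
      ...   | inj₂ (inj₂ (inj₁ refl)) = ⊥-elim (y-bare (u , ~-sym uw , u≢z , u≢x))
      ...   | inj₂ (inj₂ (inj₂ refl)) = ⊥-elim (z-bare (u , ~-sym uw , u≢x , u≢y))

      classification : Classification G c
      classification = f-case (core-iso (x ∷ y ∷ z ∷ P) unique fan-adj non-isolated covers) c≡3
        where
        unique : Unique (x ∷ y ∷ z ∷ P)
        unique = (x≢y ∷ z≢x ∘ sym ∷ All.tabulate (~-irrefl ∘ proj₁ ∘ P-nbr))
               ∷ (y≢z ∷ All.tabulate (λ t∈P → proj₁ (proj₂ (P-nbr t∈P)) ∘ sym))
               ∷ All.tabulate (λ t∈P → proj₂ (proj₂ (P-nbr t∈P)) ∘ sym)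
               ∷ select-unique _
        non-isolated : All (NonIsolated G) (x ∷ y ∷ z ∷ P)
        non-isolated = (y , xy) ∷ (z , yz) ∷ (x , zx) ∷ All.tabulate (λ t∈P → x , ~-sym (proj₁ (P-nbr t∈P)))

    -- x and y have neighbours off the triangle; these are one vertex t, and every edge lies inside
    -- {x, y, z, t}.
    module FourVertices {t} (x-nbr : NeighbourOutside x y z t) (y-pendant : ∃ (NeighbourOutside y z x)) where

      xt : x ~ t
      xt = proj₁ x-nbr

      t≢y : t ≢ y
      t≢y = proj₁ (proj₂ x-nbr)

      t≢z : t ≢ z
      t≢z = proj₂ (proj₂ x-nbr)

      t≢x : t ≢ x
      t≢x = ~-irrefl xt ∘ sym

      yt : y ~ t
      yt = subst (y ~_) (sym (pendants-coincide x-nbr (proj₂ y-pendant))) (proj₁ (proj₂ y-pendant))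

      only-t : ∀ {u w} → InTriangle u → u ~ w → ¬ InTriangle w → w ≡ t
      only-t (inj₁ refl)        xw w∉ = pendants-coincide (xw , w∉ ∘ inj₂ ∘ inj₁ , w∉ ∘ inj₂ ∘ inj₂) (yt , t≢z , t≢x)
      only-t (inj₂ (inj₁ refl)) yw w∉ = sym (pendants-coincide x-nbr (yw , w∉ ∘ inj₂ ∘ inj₂ , w∉ ∘ inj₁))
      only-t (inj₂ (inj₂ refl)) zw w∉ = R₂.pendants-coincide (zw , w∉ ∘ inj₁ , w∉ ∘ inj₂ ∘ inj₁) x-nbr

      Q : List (Fin n)
      Q = z ∷ t ∷ x ∷ y ∷ []

      covers : ∀ u w → u ~ w → u ∈ Q
      covers u w uw with u ≟ z | u ≟ t | u ≟ x | u ≟ y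
      ... | yes refl | _        | _        | _        = here refl
      ... | no _     | yes refl | _        | _        = there (here refl)
      ... | no _     | no _     | yes refl | _        = there (there (here refl))
      ... | no _     | no _     | no _     | yes refl = there (there (there (here refl)))
      ... | no u≢z   | no u≢t   | no u≢x   | no u≢y   with meets-triangle uw
      ...   | inj₁ u∈ = contradiction u∈ [ u≢x , [ u≢y , u≢z ] ]
      ...   | inj₂ w∈ = contradiction (only-t w∈ (~-sym uw) [ u≢x , [ u≢y , u≢z ] ]) u≢t

      unique : Unique Q
      unique = (t≢z ∘ sym ∷ z≢x ∷ y≢z ∘ sym ∷ []) ∷ (t≢x ∷ t≢y ∷ []) ∷ (x≢y ∷ []) ∷ [] ∷ []

      non-isolated : All (NonIsolated G) Q
      non-isolated = (x , zx) ∷ (x , ~-sym xt) ∷ (y , xy) ∷ (z , yz) ∷ []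

      k4-adj : z ~ t → ∀ i j → k4Adj i j ≡ Adj G (lookup Q i) (lookup Q j)
      k4-adj zt 0F 0F = sym (irrefl G z)
      k4-adj zt 0F 1F = sym zt
      k4-adj zt 0F 2F = sym zx
      k4-adj zt 0F 3F = sym (~-sym yz)
      k4-adj zt 1F 0F = sym (~-sym zt)
      k4-adj zt 1F 1F = sym (irrefl G t)
      k4-adj zt 1F 2F = sym (~-sym xt)
      k4-adj zt 1F 3F = sym (~-sym yt)
      k4-adj zt 2F 0F = sym (~-sym zx)
      k4-adj zt 2F 1F = sym xt
      k4-adj zt 2F 2F = sym (irrefl G x)
      k4-adj zt 2F 3F = sym xy
      k4-adj zt 3F 0F = sym yz
      k4-adj zt 3F 1F = sym yt
      k4-adj zt 3F 2F = sym (~-sym xy)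
      k4-adj zt 3F 3F = sym (irrefl G y)

      k4⁻-adj : ¬ z ~ t → ∀ i j → k4mAdj i j ≡ Adj G (lookup Q i) (lookup Q j)
      k4⁻-adj z≁t 0F 0F = sym (irrefl G z)
      k4⁻-adj z≁t 0F 1F = sym (≁⇒false z≁t)
      k4⁻-adj z≁t 0F 2F = sym zx
      k4⁻-adj z≁t 0F 3F = sym (~-sym yz)
      k4⁻-adj z≁t 1F 0F = sym (≁⇒false (z≁t ∘ ~-sym))
      k4⁻-adj z≁t 1F 1F = sym (irrefl G t)
      k4⁻-adj z≁t 1F 2F = sym (~-sym xt)
      k4⁻-adj z≁t 1F 3F = sym (~-sym yt)
      k4⁻-adj z≁t 2F 0F = sym (~-sym zx)
      k4⁻-adj z≁t 2F 1F = sym xt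
      k4⁻-adj z≁t 2F 2F = sym (irrefl G x)
      k4⁻-adj z≁t 2F 3F = sym xy
      k4⁻-adj z≁t 3F 0F = sym yz
      k4⁻-adj z≁t 3F 1F = sym yt
      k4⁻-adj z≁t 3F 2F = sym (~-sym xy)
      k4⁻-adj z≁t 3F 3F = sym (irrefl G y)

      classification : Classification G c
      classification with z ~? t
      ... | yes zt  = k4-case (core-iso Q unique (k4-adj zt) non-isolated covers) c≡3
      ... | no z≁t  = k4⁻-case (core-iso Q unique (k4⁻-adj z≁t) non-isolated covers) c≡3

  triangle : ∀ {x y z} (xy : x ~ y) (yz : y ~ z) (zx : z ~ x) →
             ℓ xy ≢ ℓ yz → ℓ yz ≢ ℓ zx → ℓ zx ≢ ℓ xy → Classification G c
  triangle {x} {y} {z} xy yz zx d₁ d₂ d₃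
    with any? (neighbourOutside? x y z) | any? (neighbourOutside? y z x) | any? (neighbourOutside? z x y)
  ... | yes (_ , tx) | yes ty       | _ =
    TriangleClassification.FourVertices.classification xy yz zx d₁ d₂ d₃ tx ty
  ... | yes tx       | no y-bare    | yes (_ , tz) =
    TriangleClassification.FourVertices.classification zx xy yz d₃ d₁ d₂ tz tx
  ... | yes _        | no y-bare    | no z-bare =
    TriangleClassification.Fan.classification xy yz zx d₁ d₂ d₃ y-bare z-bare
  ... | no x-bare    | yes (_ , ty) | yes tz =
    TriangleClassification.FourVertices.classification yz zx xy d₂ d₃ d₁ ty tz
  ... | no x-bare    | yes _        | no z-bare =
    TriangleClassification.Fan.classification yz zx xy d₂ d₃ d₁ z-bare x-bare
  ... | no x-bare    | no y-bare    | _ =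
    TriangleClassification.Fan.classification zx xy yz d₃ d₁ d₂ x-bare y-bare

  -- xy meets both va and vb, but not at v.
  chord : ∀ {v a b x y} (va : v ~ a) (vb : v ~ b) (xy : x ~ y) → x ≢ v → y ≢ v → a ≢ b →
          ℓ xy ≢ ℓ va → ℓ xy ≢ ℓ vb → Σ (a ~ b) λ ab → ℓ ab ≡ ℓ xy
  chord va vb xy x≢v y≢v a≢b ≢va ≢vb
    with meets-away-from x≢v y≢v (ℓ-meets xy va ≢va) | meets-away-from x≢v y≢v (ℓ-meets xy vb ≢vb)
  ... | inj₁ refl | inj₁ refl = contradiction refl a≢b
  ... | inj₁ refl | inj₂ refl = xy , refl
  ... | inj₂ refl | inj₁ refl = ~-sym xy , sym (ℓ-sym xy)
  ... | inj₂ refl | inj₂ refl = contradiction refl a≢b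

  claw-with-chord : ∀ {v a b d} (va : v ~ a) (vb : v ~ b) (vd : v ~ d) →
                    ℓ va ≢ ℓ vb → ℓ vb ≢ ℓ vd → ℓ vd ≢ ℓ va → a ~ b → Classification G c
  claw-with-chord va vb vd d₁ d₂ d₃ ab =
    triangle va ab (~-sym vb) (λ eq → d₃ (trans (sym ℓab≡ℓvd) (sym eq)))
      (λ eq → d₂ (trans (ℓ-sym vb) (trans (sym eq) ℓab≡ℓvd))) (λ eq → d₁ (sym (trans (ℓ-sym vb) eq)))
    where
    ℓab≡ℓvd : ℓ ab ≡ ℓ vd
    ℓab≡ℓvd = ℓ-disjoint ab vd [ [ ~-irrefl va ∘ sym , (λ { refl → d₃ refl }) ]
                               , [ ~-irrefl vb ∘ sym , (λ { refl → d₂ refl }) ] ]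

  claw : ∀ {v a b d} (va : v ~ a) (vb : v ~ b) (vd : v ~ d) →
         ℓ va ≢ ℓ vb → ℓ vb ≢ ℓ vd → ℓ vd ≢ ℓ va → Classification G c
  claw {v} {a} {b} {d} va vb vd d₁ d₂ d₃ with a ~? b | b ~? d | d ~? a
  ... | yes ab | _      | _      = claw-with-chord va vb vd d₁ d₂ d₃ ab
  ... | no _   | yes bd | _      = claw-with-chord vb vd va d₂ d₃ d₁ bd
  ... | no _   | no _   | yes da = claw-with-chord vd va vb d₃ d₁ d₂ da
  ... | no a≁b | no b≁d | no d≁a = Star.classification v centre va
    where
    centre : ∀ {x y} → x ~ y → Endpoint v x y
    centre {x} {y} xy with v ≟ x | v ≟ y
    ... | yes v≡x | _       = inj₁ v≡x
    ... | no _    | yes v≡y = inj₂ v≡y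
    ... | no v≢x  | no v≢y  with ℓ xy ≟ ℓ va | ℓ xy ≟ ℓ vb
    ...   | yes ≡va | _       = ⊥-elim (b≁d (proj₁ (chord vb vd xy (v≢x ∘ sym) (v≢y ∘ sym)
                                  (λ { refl → d₂ refl }) (λ eq → d₁ (trans (sym ≡va) eq)) (λ eq → d₃ (trans (sym eq) ≡va)))))
    ...   | no ≢va  | yes ≡vb = ⊥-elim (d≁a (~-sym (proj₁ (chord va vd xy (v≢x ∘ sym) (v≢y ∘ sym)
                                  (λ { refl → d₃ refl }) ≢va (λ eq → d₂ (trans (sym ≡vb) eq))))))
    ...   | no ≢va  | no ≢vb  = ⊥-elim (a≁b (proj₁ (chord va vb xy (v≢x ∘ sym) (v≢y ∘ sym)
                                  (λ { refl → d₁ refl }) ≢va ≢vb)))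

  three-components-at-fork : ∀ {v a b x y} (va : v ~ a) (vb : v ~ b) (xy : x ~ y) →
                             ℓ va ≢ ℓ vb → ℓ vb ≢ ℓ xy → ℓ xy ≢ ℓ va → Classification G c
  three-components-at-fork {v} {x = x} {y} va vb xy d₀₁ d₁₂ d₂₀ with (v ≟ x) ⊎-dec (v ≟ y)
  ... | yes v∈xy = let (_ , vd , ℓvd) = at-endpoint xy v∈xy in
                   claw va vb vd d₀₁ (λ eq → d₁₂ (trans eq ℓvd)) (λ eq → d₂₀ (trans (sym ℓvd) eq))
  ... | no v∉xy  = let (ab , ℓab) = chord va vb xy (v∉xy ∘ inj₁ ∘ sym) (v∉xy ∘ inj₂ ∘ sym)
                                          (λ { refl → d₀₁ refl }) d₂₀ (d₁₂ ∘ sym) in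
                   triangle va ab (~-sym vb) (λ eq → d₂₀ (trans (sym ℓab) (sym eq)))
                     (λ eq → d₁₂ (trans (ℓ-sym vb) (sym (trans (sym ℓab) eq))))
                     (λ eq → d₀₁ (sym (trans (ℓ-sym vb) eq)))

  three-components : (k₀ k₁ k₂ : Fin c) → k₀ ≢ k₁ → k₁ ≢ k₂ → k₂ ≢ k₀ → Classification G c
  three-components k₀ k₁ k₂ d₀₁ d₁₂ d₂₀ with ℓ-onto k₀ | ℓ-onto k₁ | ℓ-onto k₂
  ... | _ , _ , p₀ , refl | _ , _ , p₁ , refl | _ , _ , p₂ , refl with fork p₀ p₁ d₀₁
  ...   | fork-at va vb ℓva ℓvb = three-components-at-fork va vb p₂
                                    (λ eq → d₀₁ (trans (sym ℓva) (trans eq ℓvb)))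
                                    (λ eq → d₁₂ (trans (sym ℓvb) eq)) (λ eq → d₂₀ (trans eq ℓva))

  -- Exactly two components

  -- When all edges lie inside {p, q} ∪ {r, s}, an edge disjoint from pq is rs and vice versa, so
  -- the component of pq contains no other edge.
  module Matching {p q r s} (within : ∀ u w → u ~ w → Endpoint u p q ⊎ Endpoint u r s) where

    Inside : Edge G → Set
    Inside e = (p ∈ₑ e × q ∈ₑ e) ⊎ (r ∈ₑ e × s ∈ₑ e)

    private
      outside : ∀ {x y u} (e e′ : Edge G) → x ∈ₑ e → y ∈ₑ e → CoAdj {G = G} e e′ → u ∈ₑ e′ →
                ¬ Endpoint u x y
      outside e e′ x∈e _   coadj u∈e′ (inj₁ refl) = coadj-avoids {e} {e′} coadj x∈e u∈e′
      outside e e′ _   y∈e coadj u∈e′ (inj₂ refl) = coadj-avoids {e} {e′} coadj y∈e u∈e′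

      within₁ : (e : Edge G) → Endpoint (proj₁ (proj₁ e)) p q ⊎ Endpoint (proj₁ (proj₁ e)) r s
      within₁ e = within _ _ (edge-adj e)

      within₂ : (e : Edge G) → Endpoint (proj₂ (proj₁ e)) p q ⊎ Endpoint (proj₂ (proj₁ e)) r s
      within₂ e = within _ _ (~-sym (edge-adj e))

      step : ∀ {e e′} → CoAdj {G = G} e e′ → Inside e → Inside e′
      step {e} {e′} coadj (inj₁ (p∈e , q∈e)) =
        inj₂ (spans e′ (in-rs (inj₁ refl) (within₁ e′)) (in-rs (inj₂ refl) (within₂ e′)))
        where
        in-rs : ∀ {u} → u ∈ₑ e′ → Endpoint u p q ⊎ Endpoint u r s → Endpoint u r s
        in-rs u∈e′ = [ flip contradiction (outside e e′ p∈e q∈e coadj u∈e′) , id ]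
      step {e} {e′} coadj (inj₂ (r∈e , s∈e)) =
        inj₁ (spans e′ (in-pq (inj₁ refl) (within₁ e′)) (in-pq (inj₂ refl) (within₂ e′)))
        where
        in-pq : ∀ {u} → u ∈ₑ e′ → Endpoint u p q ⊎ Endpoint u r s → Endpoint u p q
        in-pq u∈e′ = [ id , flip contradiction (outside e e′ r∈e s∈e coadj u∈e′) ]

      invariant : ∀ {e e′} → Reach (CoAdj {G = G}) e e′ → Inside e → Inside e′
      invariant ε             = id
      invariant (_◅_ {i} {j} coadj rest) = invariant rest ∘ step {i} {j} coadj

      separated : (pq : p ~ q) → ∀ {t} (pt : p ~ t) → ¬ Inside (edge pt) → ℓ pq ≢ ℓ pt
      separated pq pt pt-outside eq =
        pt-outside (invariant (ℓ-reach pq pt eq) (inj₁ (∈-edge⁺ pq (inj₁ refl) , ∈-edge⁺ pq (inj₂ refl))))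

    diagonal⇒3≤c : (pq : p ~ q) (pr : p ~ r) (ps : p ~ s) → q ≢ r → q ≢ s → ℓ pr ≢ ℓ ps → 3 ≤ c
    diagonal⇒3≤c pq pr ps q≢r q≢s ℓpr≢ℓps = unique⇒length≤ (ℓ pq ∷ ℓ pr ∷ ℓ ps ∷ [])
      ((separated pq pr pr-outside ∷ separated pq ps ps-outside ∷ []) ∷ (ℓpr≢ℓps ∷ []) ∷ [] ∷ [])
      where
      pr-outside : ¬ Inside (edge pr)
      pr-outside = [ (λ (_ , q∈) → [ ~-irrefl pq ∘ sym , q≢r ] (∈-edge⁻ pr q∈))
                   , (λ (_ , s∈) → [ ~-irrefl ps ∘ sym , ℓpr≢ℓps ∘ ℓ-cong pr ps ∘ sym ]
                                      (∈-edge⁻ pr s∈)) ]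
      ps-outside : ¬ Inside (edge ps)
      ps-outside = [ (λ (_ , q∈) → [ ~-irrefl pq ∘ sym , q≢s ] (∈-edge⁻ ps q∈))
                   , (λ (r∈ , _) → [ ~-irrefl pr ∘ sym , ℓpr≢ℓps ∘ ℓ-cong pr ps ] (∈-edge⁻ ps r∈)) ]

  -- An edge avoiding {v, a} shares the component of va, so it meets vb away from v.
  cross : ∀ {v a b} (va : v ~ a) (vb : v ~ b) → ℓ va ≢ ℓ vb → Avoiding v a →
          Σ (Fin n) λ w → Σ (b ~ w) λ bw → ℓ bw ≡ ℓ va × w ≢ v × w ≢ a
  cross va vb ℓva≢ℓvb (x , y , xy , xy∌va)
    with meets-away-from (xy∌va ∘ inj₁ ∘ inj₁) (xy∌va ∘ inj₂ ∘ inj₁)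
           (ℓ-meets xy vb (ℓva≢ℓvb ∘ trans (sym (ℓ-disjoint xy va xy∌va))))
  ... | inj₁ refl = y , xy , ℓ-disjoint xy va xy∌va , xy∌va ∘ inj₂ ∘ inj₁ , xy∌va ∘ inj₂ ∘ inj₂
  ... | inj₂ refl = x , ~-sym xy , trans (sym (ℓ-sym xy)) (ℓ-disjoint xy va xy∌va) ,
                    xy∌va ∘ inj₁ ∘ inj₁ , xy∌va ∘ inj₁ ∘ inj₂

  module Square (c≡2 : c ≡ 2) {v a w b} (va : v ~ a) (vb : v ~ b) (aw : a ~ w) (bw : b ~ w)
                (ℓva≢ℓvb : ℓ va ≢ ℓ vb) (ℓbw≡ℓva : ℓ bw ≡ ℓ va) (ℓaw≡ℓvb : ℓ aw ≡ ℓ vb)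
                (w≢v : w ≢ v) where

    v≢a : v ≢ a
    v≢a = ~-irrefl va

    v≢b : v ≢ b
    v≢b = ~-irrefl vb

    a≢w : a ≢ w
    a≢w = ~-irrefl aw

    b≢w : b ≢ w
    b≢w = ~-irrefl bw

    a≢b : a ≢ b
    a≢b refl = ℓva≢ℓvb refl

    within : ∀ u u′ → u ~ u′ → Endpoint u v w ⊎ Endpoint u a b
    within u u′ uu′ with ℓ uu′ ≟ ℓ va
    ... | no ≢va = [ [ inj₁ ∘ inj₁ , inj₂ ∘ inj₁ ] , [ inj₂ ∘ inj₂ , inj₁ ∘ inj₂ ] ]
                     (meets-both (ℓ-meets uu′ va ≢va) (ℓ-meets uu′ bw (≢va ∘ flip trans ℓbw≡ℓva))
                                 [ [ v≢b , w≢v ∘ sym ] , [ a≢b , a≢w ] ])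
    ... | yes ≡va = [ [ inj₁ ∘ inj₁ , inj₂ ∘ inj₂ ] , [ inj₂ ∘ inj₁ , inj₁ ∘ inj₂ ] ]
                      (meets-both (ℓ-meets uu′ vb (ℓva≢ℓvb ∘ trans (sym ≡va)))
                                  (ℓ-meets uu′ aw (ℓva≢ℓvb ∘ trans (sym ≡va) ∘ flip trans ℓaw≡ℓvb))
                                  [ [ v≢a , w≢v ∘ sym ] , [ a≢b ∘ sym , b≢w ] ])

    3≰c : ¬ 3 ≤ c
    3≰c 3≤c with subst (3 ≤_) c≡2 3≤c
    ... | s≤s (s≤s ())

    -- A diagonal would make G a K₄ minus at most one edge, whose coline graph has three components.
    v≁w : ¬ v ~ w
    v≁w vw = 3≰c (Matching.diagonal⇒3≤c within vw va vb (a≢w ∘ sym) (b≢w ∘ sym) ℓva≢ℓvb)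

    a≁b : ¬ a ~ b
    a≁b ab = 3≰c (Matching.diagonal⇒3≤c (λ u u′ → swap ∘ within u u′) ab (~-sym va) aw (v≢b ∘ sym) b≢w
                    (λ eq → ℓva≢ℓvb (trans (ℓ-sym va) (trans eq ℓaw≡ℓvb))))

    Q : List (Fin n)
    Q = v ∷ a ∷ w ∷ b ∷ []

    covers : ∀ u u′ → u ~ u′ → u ∈ Q
    covers u u′ uu′ with within u u′ uu′
    ... | inj₁ (inj₁ refl) = here refl
    ... | inj₁ (inj₂ refl) = there (there (here refl))
    ... | inj₂ (inj₁ refl) = there (here refl)
    ... | inj₂ (inj₂ refl) = there (there (there (here refl)))

    c4-adj : ∀ i j → c4Adj i j ≡ Adj G (lookup Q i) (lookup Q j)
    c4-adj 0F 0F = sym (irrefl G v)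
    c4-adj 0F 1F = sym va
    c4-adj 0F 2F = sym (≁⇒false v≁w)
    c4-adj 0F 3F = sym vb
    c4-adj 1F 0F = sym (~-sym va)
    c4-adj 1F 1F = sym (irrefl G a)
    c4-adj 1F 2F = sym aw
    c4-adj 1F 3F = sym (≁⇒false a≁b)
    c4-adj 2F 0F = sym (≁⇒false (v≁w ∘ ~-sym))
    c4-adj 2F 1F = sym (~-sym aw)
    c4-adj 2F 2F = sym (irrefl G w)
    c4-adj 2F 3F = sym (~-sym bw)
    c4-adj 3F 0F = sym (~-sym vb)
    c4-adj 3F 1F = sym (≁⇒false (a≁b ∘ ~-sym))
    c4-adj 3F 2F = sym bw
    c4-adj 3F 3F = sym (irrefl G b)

    classification : Classification G c
    classification = c4-case (core-iso Q unique c4-adj non-isolated covers) c≡2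
      where
      unique : Unique Q
      unique = (v≢a ∷ w≢v ∘ sym ∷ v≢b ∷ []) ∷ (a≢w ∷ a≢b ∷ []) ∷ (b≢w ∘ sym ∷ []) ∷ [] ∷ []
      non-isolated : All (NonIsolated G) Q
      non-isolated = (a , va) ∷ (w , aw) ∷ (b , ~-sym bw) ∷ (v , ~-sym vb) ∷ []

  two-components-at-fork : c ≡ 2 → ∀ {v a b} (va : v ~ a) (vb : v ~ b) → ℓ va ≢ ℓ vb → Classification G c
  two-components-at-fork c≡2 {v} {a} {b} va vb ℓva≢ℓvb with avoiding? v a | avoiding? v b
  ... | no none | _       = typeA-case va (¬avoiding⇒dominated none) cc c≡2
  ... | yes _   | no none = typeA-case vb (¬avoiding⇒dominated none) cc c≡2
  ... | yes off-va | yes off-vb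
    with cross va vb ℓva≢ℓvb off-va | cross vb va (ℓva≢ℓvb ∘ sym) off-vb
  ... | w , bw , ℓbw≡ℓva , w≢v , w≢a | z , az , ℓaz≡ℓvb , _ , z≢b
    with ℓ-meets bw az (λ eq → ℓva≢ℓvb (trans (sym ℓbw≡ℓva) (trans eq ℓaz≡ℓvb)))
  ... | inj₁ (inj₁ refl) = ⊥-elim (ℓva≢ℓvb refl)
  ... | inj₁ (inj₂ b≡z)  = contradiction (sym b≡z) z≢b
  ... | inj₂ (inj₁ w≡a)  = contradiction w≡a w≢a
  ... | inj₂ (inj₂ refl) = Square.classification c≡2 va vb az bw ℓva≢ℓvb ℓbw≡ℓva ℓaz≡ℓvb w≢v

  two-components : c ≡ 2 → ∀ {e e′} → ¬ Reach (CoAdj {G = G}) e e′ → Classification G c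
  two-components c≡2 {e} {e′} e↛e′ with fork (edge-adj e) (edge-adj e′) (unreachable⇒ℓ≢ e↛e′)
  ... | fork-at va vb ℓva ℓvb =
    two-components-at-fork c≡2 va vb (λ eq → unreachable⇒ℓ≢ e↛e′ (trans (sym ℓva) (trans eq ℓvb)))

lemma2p1 : ∀ {n} (G : Graph n) → Disconnected (CoAdj {G = G}) →
    ∀ (c : ℕ) → ComponentCount (CoAdj {G = G}) c →
      (Σ ℕ λ l → 1 ≤ l × CoreIso G (starAdj l) × c ≡ l × ρ G c ≡ 2 * l)
    ⊎ (IsTypeA G × c ≡ 2 × ρ G c ≡ edgeCount G + 2)
    ⊎ (CoreIso G c4Adj × c ≡ 2 × ρ G c ≡ 6)
    ⊎ (Σ ℕ λ k → 2 ≤ k × CoreIso G (fAdj k) × c ≡ 3 × ρ G c ≡ k + 4)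
    ⊎ (CoreIso G k4mAdj × c ≡ 3 × ρ G c ≡ 8)
    ⊎ (CoreIso G k4Adj × c ≡ 3 × ρ G c ≡ 9)
lemma2p1 G (e₀ , e₁ , e₀↛e₁) zero (label , _) with label e₀
... | ()
lemma2p1 G (e₀ , e₁ , e₀↛e₁) 1 (label , _ , reach-iff) with label e₀ in l₀ | label e₁ in l₁
... | zero | zero = contradiction (proj₁ (reach-iff e₀ e₁) (trans l₀ (sym l₁))) e₀↛e₁
lemma2p1 G (e₀ , e₁ , e₀↛e₁) 2 cc = Components.two-components G cc refl e₀↛e₁
lemma2p1 G _ (suc (suc (suc c))) cc = Components.three-components G cc 0F 1F 2F (λ ()) (λ ()) (λ ())
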